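{- Let $n$ be a positive integer and let $(\alpha,\beta)\in\{(0,0),(1,0),(1,1),(2,1),(3,1),(3,2),(4,2)\}$. Let \[ w_{n,\alpha,\beta}=b^{n+1}(ab)^n b^{2n+1+\alpha}a^{2n+1+\beta}. \] Then $S_d(w_{n,\alpha,\beta})\ge 3n+1+\left[\frac{\alpha+\beta}{3}\right]$, where $[x]$ denotes the integer part of $x$.
   Context: A word is a finite word over the alphabet $\{a,b\}$, written multiplicatively (so $b^{m}$ is $m$ consecutive letters $b$ and $(ab)^n$ is $ab$ repeated $n$ times). A word $c_1\cdots c_m$ is a palindrome if $c_i=c_{m-i+1}$ for all $i\le m$, and an antipalindrome if $c_i\ne c_{m-i+1}$ for all $i\le m$. Deleting letters from $w$ means passing to a subsequence of $w$. For a word $w$, $S_d(w)$ is the minimal number of letters of $w$ whose deletion from $w$ yields a palindrome or an antipalindrome. -}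

module Defs where

open import Data.Nat using (ℕ; zero; suc; _+_; _*_; _≤_; _∸_)
open import Data.List using (List; []; _∷_; _++_; reverse; replicate; concat; length)
open import Data.List.Relation.Binary.Sublist.Propositional using (_⊆_)
open import Data.List.Relation.Binary.Pointwise using (Pointwise)
open import Data.Product using (_×_; _,_)
open import Data.Sum using (_⊎_)
open import Relation.Binary.PropositionalEquality using (_≡_; _≢_)

data Letter : Set where
  a b : Letter

Word : Set
Word = List Letter

_^ʷ_ : Word → ℕ → Word
u ^ʷ zero  = []
u ^ʷ suc k = u ++ (u ^ʷ k)

IsPalindrome : Word → Set
IsPalindrome w = reverse w ≡ w

-- antipalindrome: cᵢ ≠ c_{m-i+1} for all i, i.e. w and its reversal differ at every position
IsAntipalindrome : Word → Set
IsAntipalindrome w = Pointwise _≢_ w (reverse w)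

PalOrAnti : Word → Set
PalOrAnti u = IsPalindrome u ⊎ IsAntipalindrome u

-- "S_d(w) ≥ k": every way of deleting letters from w (passing to a
-- subsequence u ⊆ w) that yields a palindrome or antipalindrome deletes
-- at least k letters.  Since S_d(w) is the minimum of these deletion
-- counts, this is exactly S_d(w) ≥ k.
Sd≥ : Word → ℕ → Set
Sd≥ w k = ∀ (u : Word) → u ⊆ w → PalOrAnti u → k ≤ length w ∸ length u

wNAB : ℕ → ℕ → ℕ → Word
wNAB n α β =
  replicate (suc n) b ++ ((a ∷ b ∷ []) ^ʷ n) ++
  replicate (2 * n + 1 + α) b ++ replicate (2 * n + 1 + β) a

data Admissible : ℕ → ℕ → Set where
  p00 : Admissible 0 0
  p10 : Admissible 1 0
  p11 : Admissible 1 1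
  p21 : Admissible 2 1
  p31 : Admissible 3 1
  p32 : Admissible 3 2
  p42 : Admissible 4 2

-- Every subsequence of w = b^(n+1) (ab)^n b^P a^Q has the shape b^i y b^j a^l with y a
-- subsequence of (ab)^n.  Comparing a palindrome with its reversal, its last run of a
-- letter is no longer than its first run of that letter; for an antipalindrome the same
-- holds with the first run of the complementary letter.  Together with the sparsity of
-- (ab)^n (a block b^t followed by z inside (ab)^n forces 2t + |z| ≤ 2n), this bounds
-- palindromes by 2n+1+P and, since antipalindromes contain as many a's as b's,
-- antipalindromes by 2Q.  For the admissible (α, β) both bounds leave at least
-- 3n+1+[(α+β)/3] letters to delete.

module Submission where

open import Defs
open import Data.Nat using (ℕ; zero; suc; _+_; _*_; _/_; _≤_; z≤n; s≤s)
open import Data.Nat.Properties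
open import Data.List using ([]; _∷_; _++_; reverse; replicate; length; map)
open import Data.List.Properties using (length-++; length-replicate; ++-assoc; reverse-++; unfold-reverse; map-++; map-replicate; ∷-injectiveʳ)
open import Data.List.Relation.Binary.Sublist.Propositional using (_⊆_; []; _∷_; _∷ʳ_)
open import Data.List.Relation.Binary.Sublist.Propositional.Properties using (length-mono-≤)
open import Data.List.Relation.Binary.Pointwise using (Pointwise; []; _∷_)
open import Data.Product using (_×_; _,_; ∃-syntax)
open import Data.Sum using (inj₁; inj₂)
open import Relation.Binary.PropositionalEquality
open import Relation.Nullary using (contradiction)
open import Data.Nat.Tactic.RingSolver using (solve-∀)

infixr 8 _^_

_^_ : Letter → ℕ → Word
c ^ k = replicate k c

ab^ : ℕ → Word
ab^ n = (a ∷ b ∷ []) ^ʷ n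

complement : Letter → Letter
complement a = b
complement b = a

≢⇒complement : ∀ {x y} → x ≢ y → y ≡ complement x
≢⇒complement {a} {a} x≢y = contradiction refl x≢y
≢⇒complement {a} {b} _   = refl
≢⇒complement {b} {a} _   = refl
≢⇒complement {b} {b} x≢y = contradiction refl x≢y

antipalindrome⇒reverse≡map-complement : ∀ {u} → IsAntipalindrome u → reverse u ≡ map complement u
antipalindrome⇒reverse≡map-complement = pointwise
  where
  pointwise : ∀ {u v} → Pointwise _≢_ u v → v ≡ map complement u
  pointwise []           = refl
  pointwise (x≢y ∷ rest) = cong₂ _∷_ (≢⇒complement x≢y) (pointwise rest)

δ : Letter → Letter → ℕ
δ a a = 1
δ a b = 0
δ b a = 0
δ b b = 1

count : Letter → Word → ℕ
count c []      = 0
count c (x ∷ w) = δ c x + count c w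

count-++ : ∀ c xs ys → count c (xs ++ ys) ≡ count c xs + count c ys
count-++ c []       ys = refl
count-++ c (x ∷ xs) ys = trans (cong (δ c x +_) (count-++ c xs ys)) (sym (+-assoc (δ c x) _ _))

count-reverse : ∀ c w → count c (reverse w) ≡ count c w
count-reverse c []      = refl
count-reverse c (x ∷ w) = begin
  count c (reverse (x ∷ w))        ≡⟨ cong (count c) (unfold-reverse x w) ⟩
  count c (reverse w ++ x ∷ [])   ≡⟨ count-++ c (reverse w) (x ∷ []) ⟩
  count c (reverse w) + (δ c x + 0) ≡⟨ cong₂ _+_ (count-reverse c w) (+-identityʳ (δ c x)) ⟩
  count c w + δ c x                ≡⟨ +-comm (count c w) (δ c x) ⟩
  δ c x + count c w                ∎
  where open ≡-Reasoning

count-map-complement : ∀ c w → count c (map complement w) ≡ count (complement c) w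
count-map-complement c []      = refl
count-map-complement c (x ∷ w) = cong₂ _+_ (δ-complement c x) (count-map-complement c w)
  where
  δ-complement : ∀ c x → δ c (complement x) ≡ δ (complement c) x
  δ-complement a a = refl
  δ-complement a b = refl
  δ-complement b a = refl
  δ-complement b b = refl

length≡count-a+count-b : ∀ w → length w ≡ count a w + count b w
length≡count-a+count-b []      = refl
length≡count-a+count-b (a ∷ w) = cong suc (length≡count-a+count-b w)
length≡count-a+count-b (b ∷ w) = trans (cong suc (length≡count-a+count-b w)) (sym (+-suc (count a w) (count b w)))

count-mono : ∀ c {u w} → u ⊆ w → count c u ≤ count c w
count-mono c []                 = z≤n
count-mono c (x ∷ʳ u⊆w)         = m≤n⇒m≤o+n (δ c x) (count-mono c u⊆w)
count-mono c (_∷_ {x} refl u⊆w) = +-monoʳ-≤ (δ c x) (count-mono c u⊆w)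

count-^ : ∀ c k → count c (c ^ k) ≡ k
count-^ a zero    = refl
count-^ a (suc k) = cong suc (count-^ a k)
count-^ b zero    = refl
count-^ b (suc k) = cong suc (count-^ b k)

count-complement-^ : ∀ c k → count c (complement c ^ k) ≡ 0
count-complement-^ a zero    = refl
count-complement-^ a (suc k) = count-complement-^ a k
count-complement-^ b zero    = refl
count-complement-^ b (suc k) = count-complement-^ b k

count-ab^ : ∀ c n → count c (ab^ n) ≡ n
count-ab^ a zero    = refl
count-ab^ a (suc n) = cong suc (count-ab^ a n)
count-ab^ b zero    = refl
count-ab^ b (suc n) = cong suc (count-ab^ b n)

length-ab^ : ∀ n → length (ab^ n) ≡ n + n
length-ab^ zero    = refl
length-ab^ (suc n) = cong suc (trans (cong suc (length-ab^ n)) (sym (+-suc n n)))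

antipalindrome-balanced : ∀ {u} → IsAntipalindrome u → count a u ≡ count b u
antipalindrome-balanced {u} anti = begin
  count a u                      ≡⟨ count-reverse a u ⟨
  count a (reverse u)            ≡⟨ cong (count a) (antipalindrome⇒reverse≡map-complement anti) ⟩
  count a (map complement u)     ≡⟨ count-map-complement a u ⟩
  count b u                      ∎
  where open ≡-Reasoning

antipalindrome-length : ∀ c {u k} → IsAntipalindrome u → count c u ≤ k → length u ≤ k + k
antipalindrome-length a {u} anti c≤k = begin
  length u              ≡⟨ length≡count-a+count-b u ⟩
  count a u + count b u ≡⟨ cong (count a u +_) (antipalindrome-balanced anti) ⟨
  count a u + count a u ≤⟨ +-mono-≤ c≤k c≤k ⟩
  _                     ∎
  where open ≤-Reasoning
antipalindrome-length b {u} anti c≤k = begin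
  length u              ≡⟨ length≡count-a+count-b u ⟩
  count a u + count b u ≡⟨ cong (_+ count b u) (antipalindrome-balanced anti) ⟩
  count b u + count b u ≤⟨ +-mono-≤ c≤k c≤k ⟩
  _                     ∎
  where open ≤-Reasoning

^-++-^ : ∀ c i t → c ^ i ++ c ^ t ≡ c ^ (i + t)
^-++-^ c zero    t = refl
^-++-^ c (suc i) t = cong (c ∷_) (^-++-^ c i t)

reverse-^ : ∀ c k → reverse (c ^ k) ≡ c ^ k
reverse-^ c zero    = refl
reverse-^ c (suc k) = begin
  reverse (c ^ suc k)   ≡⟨ unfold-reverse c (c ^ k) ⟩
  reverse (c ^ k) ++ c ^ 1 ≡⟨ cong (_++ c ^ 1) (reverse-^ c k) ⟩
  c ^ k ++ c ^ 1        ≡⟨ ^-++-^ c k 1 ⟩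
  c ^ (k + 1)           ≡⟨ cong (c ^_) (+-comm k 1) ⟩
  c ^ suc k             ∎
  where open ≡-Reasoning

^-++-^-++ : ∀ c i t x r → c ^ i ++ (c ^ t ++ x) ++ r ≡ c ^ (i + t) ++ x ++ r
^-++-^-++ c zero    t x r = ++-assoc (c ^ t) x r
^-++-^-++ c (suc i) t x r = cong (c ∷_) (^-++-^-++ c i t x r)

length-^-++ : ∀ c k z → length (c ^ k ++ z) ≡ k + length z
length-^-++ c k z = trans (length-++ (c ^ k)) (cong (_+ length z) (length-replicate k))

data Run (c : Letter) : Word → Set where
  only   : ∀ k → Run c (c ^ k)
  switch : ∀ k s → Run c (c ^ k ++ complement c ∷ s)

run : ∀ c w → Run c w
run c [] = only 0
run a (a ∷ w) with run a w
... | only k     = only (suc k)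
... | switch k s = switch (suc k) s
run a (b ∷ w) = switch 0 w
run b (a ∷ w) = switch 0 w
run b (b ∷ w) with run b w
... | only k     = only (suc k)
... | switch k s = switch (suc k) s

leading-run-≤ : ∀ {c} k m {r s} → c ^ k ++ r ≡ c ^ m ++ complement c ∷ s → k ≤ m
leading-run-≤           zero    m       _  = z≤n
leading-run-≤ {a}       (suc k) zero    ()
leading-run-≤ {b}       (suc k) zero    ()
leading-run-≤           (suc k) (suc m) eq = s≤s (leading-run-≤ k m (∷-injectiveʳ eq))

map-complement-^-++ : ∀ c k x → map complement (c ^ k ++ x) ≡ complement c ^ k ++ map complement x
map-complement-^-++ c k x = trans (map-++ complement (c ^ k) x) (cong (_++ map complement x) (map-replicate complement k c))

palindrome-run-≤ : ∀ {c u} k m {r s} → IsPalindrome u →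
  reverse u ≡ c ^ k ++ r → u ≡ c ^ m ++ complement c ∷ s → k ≤ m
palindrome-run-≤ k m pal rev≡ u≡ = leading-run-≤ k m (trans (sym rev≡) (trans pal u≡))

antipalindrome-run-≤ : ∀ {c u} k m {r s} → IsAntipalindrome u →
  reverse u ≡ complement c ^ k ++ r → u ≡ c ^ m ++ complement c ∷ s → k ≤ m
antipalindrome-run-≤ {c} {u} k m {r} {s} anti rev≡ u≡ = leading-run-≤ k m (begin
  complement c ^ k ++ r                        ≡⟨ rev≡ ⟨
  reverse u                                    ≡⟨ antipalindrome⇒reverse≡map-complement anti ⟩
  map complement u                             ≡⟨ cong (map complement) u≡ ⟩
  map complement (c ^ m ++ complement c ∷ s)   ≡⟨ map-complement-^-++ c m _ ⟩
  complement c ^ m ++ complement (complement c) ∷ map complement s ∎)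
  where open ≡-Reasoning

⊆-++-split : ∀ xs {ys u : Word} → u ⊆ xs ++ ys →
  ∃[ u₁ ] ∃[ u₂ ] (u ≡ u₁ ++ u₂ × u₁ ⊆ xs × u₂ ⊆ ys)
⊆-++-split []       u⊆ys = [] , _ , refl , [] , u⊆ys
⊆-++-split (x ∷ xs) (.x ∷ʳ u⊆) with ⊆-++-split xs u⊆
... | u₁ , u₂ , refl , u₁⊆ , u₂⊆ = u₁ , u₂ , refl , x ∷ʳ u₁⊆ , u₂⊆
⊆-++-split (x ∷ xs) (refl ∷ u⊆) with ⊆-++-split xs u⊆
... | u₁ , u₂ , refl , u₁⊆ , u₂⊆ = x ∷ u₁ , u₂ , refl , refl ∷ u₁⊆ , u₂⊆

⊆-^ : ∀ c k {u} → u ⊆ c ^ k → ∃[ i ] (u ≡ c ^ i × i ≤ k)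
⊆-^ c zero    []          = 0 , refl , z≤n
⊆-^ c (suc k) (.c ∷ʳ u⊆)  with i , refl , i≤k ← ⊆-^ c k u⊆ = i , refl , m≤n⇒m≤1+n i≤k
⊆-^ c (suc k) (refl ∷ u⊆) with i , refl , i≤k ← ⊆-^ c k u⊆ = suc i , refl , s≤s i≤k

b^-++-⊆-ab^ : ∀ t n {z} → b ^ t ++ z ⊆ ab^ n → ∃[ m ] (t + m ≤ n × z ⊆ ab^ m)
b^-++-⊆-ab^ zero    n       z⊆                   = n , ≤-refl , z⊆
b^-++-⊆-ab^ (suc t) (suc n) (.a ∷ʳ (.b ∷ʳ p))    with b^-++-⊆-ab^ (suc t) n p
... | m , ≤n , z⊆ = m , m≤n⇒m≤1+n ≤n , z⊆
b^-++-⊆-ab^ (suc t) (suc n) (.a ∷ʳ (refl ∷ p))   with b^-++-⊆-ab^ t n p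
... | m , ≤n , z⊆ = m , s≤s ≤n , z⊆

a^-++-⊆-ab^ : ∀ e n {z} → a ^ e ++ z ⊆ ab^ n → ∃[ m ] (e + m ≤ n × z ⊆ b ∷ ab^ m)
a^-++-⊆-ab^ zero    n       z⊆                      = n , ≤-refl , b ∷ʳ z⊆
a^-++-⊆-ab^ (suc e) (suc n) (.a ∷ʳ (.b ∷ʳ p))       with a^-++-⊆-ab^ (suc e) n p
... | m , ≤n , z⊆ = m , m≤n⇒m≤1+n ≤n , z⊆
a^-++-⊆-ab^ (suc zero) (suc n) (refl ∷ z⊆)          = n , ≤-refl , z⊆
a^-++-⊆-ab^ (suc (suc e)) (suc n) (refl ∷ (.b ∷ʳ p)) with a^-++-⊆-ab^ (suc e) n p
... | m , ≤n , z⊆ = m , s≤s ≤n , z⊆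

b^-++-⊆-ab^-length : ∀ t n {z} → b ^ t ++ z ⊆ ab^ n → t + length (b ^ t ++ z) ≤ n + n
b^-++-⊆-ab^-length t n {z} p with b^-++-⊆-ab^ t n p
... | m , t+m≤n , z⊆ = begin
  t + length (b ^ t ++ z) ≡⟨ cong (t +_) (length-^-++ b t z) ⟩
  t + (t + length z)      ≤⟨ +-monoʳ-≤ t (+-monoʳ-≤ t z≤) ⟩
  t + (t + (m + m))       ≡⟨ regroup t m ⟩
  (t + m) + (t + m)       ≤⟨ +-mono-≤ t+m≤n t+m≤n ⟩
  n + n                   ∎
  where
  open ≤-Reasoning
  z≤ : length z ≤ m + m
  z≤ = subst (length z ≤_) (length-ab^ m) (length-mono-≤ z⊆)
  regroup : ∀ t m → t + (t + (m + m)) ≡ (t + m) + (t + m)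
  regroup = solve-∀

a^-++-⊆-ab^-length : ∀ e n {z} → a ^ e ++ z ⊆ ab^ n → e + length (a ^ e ++ z) ≤ suc (n + n)
a^-++-⊆-ab^-length e n {z} p with a^-++-⊆-ab^ e n p
... | m , e+m≤n , z⊆ = begin
  e + length (a ^ e ++ z)  ≡⟨ cong (e +_) (length-^-++ a e z) ⟩
  e + (e + length z)       ≤⟨ +-monoʳ-≤ e (+-monoʳ-≤ e z≤) ⟩
  e + (e + suc (m + m))    ≡⟨ regroup e m ⟩
  suc ((e + m) + (e + m))  ≤⟨ s≤s (+-mono-≤ e+m≤n e+m≤n) ⟩
  suc (n + n)              ∎
  where
  open ≤-Reasoning
  z≤ : length z ≤ suc (m + m)
  z≤ = subst (λ k → length z ≤ suc k) (length-ab^ m) (length-mono-≤ z⊆)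
  regroup : ∀ e m → e + (e + suc (m + m)) ≡ suc ((e + m) + (e + m))
  regroup = solve-∀

b^-++-⊆-ab^-count : ∀ t n {z} → b ^ t ++ z ⊆ ab^ n → t + count a (b ^ t ++ z) ≤ n
b^-++-⊆-ab^-count t n {z} p with b^-++-⊆-ab^ t n p
... | m , t+m≤n , z⊆ = begin
  t + count a (b ^ t ++ z)             ≡⟨ cong (t +_) (count-++ a (b ^ t) z) ⟩
  t + (count a (b ^ t) + count a z)    ≡⟨ cong (λ k → t + (k + count a z)) (count-complement-^ a t) ⟩
  t + count a z                        ≤⟨ +-monoʳ-≤ t (subst (count a z ≤_) (count-ab^ a m) (count-mono a z⊆)) ⟩
  t + m                                ≤⟨ t+m≤n ⟩
  n                                    ∎
  where open ≤-Reasoning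

^-⊆-ab^ : ∀ c k n → c ^ k ⊆ ab^ n → k ≤ n
^-⊆-ab^ c k n p = subst₂ _≤_ (count-^ c k) (count-ab^ c n) (count-mono c p)

frame : ℕ → ℕ → ℕ → Word
frame n P Q = b ^ suc n ++ ab^ n ++ b ^ P ++ a ^ Q

length-frame : ∀ n P Q → length (frame n P Q) ≡ suc n + ((n + n) + (P + Q))
length-frame n P Q = begin
  length (b ^ suc n ++ ab^ n ++ b ^ P ++ a ^ Q)     ≡⟨ length-^-++ b (suc n) _ ⟩
  suc n + length (ab^ n ++ b ^ P ++ a ^ Q)          ≡⟨ cong (suc n +_) (length-++ (ab^ n)) ⟩
  suc n + (length (ab^ n) + length (b ^ P ++ a ^ Q)) ≡⟨ cong₂ (λ x z → suc n + (x + z)) (length-ab^ n) (length-^-++ b P _) ⟩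
  suc n + ((n + n) + (P + length (a ^ Q)))          ≡⟨ cong (λ x → suc n + ((n + n) + (P + x))) (length-replicate Q) ⟩
  suc n + ((n + n) + (P + Q))                       ∎
  where open ≡-Reasoning

data Subframe (n P Q : ℕ) : Word → Set where
  subframe : ∀ {i y j l} → i ≤ suc n → y ⊆ ab^ n → j ≤ P → l ≤ Q →
             Subframe n P Q (b ^ i ++ y ++ b ^ j ++ a ^ l)

⊆-frame⇒Subframe : ∀ n P Q {u} → u ⊆ frame n P Q → Subframe n P Q u
⊆-frame⇒Subframe n P Q p
  with _ , _ , refl , p₁ , q₁ ← ⊆-++-split (b ^ suc n) p
  with y , _ , refl , p₂ , q₂ ← ⊆-++-split (ab^ n) q₁
  with _ , _ , refl , p₃ , p₄ ← ⊆-++-split (b ^ P) q₂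
  with _ , refl , i≤ ← ⊆-^ b (suc n) p₁
  with _ , refl , j≤ ← ⊆-^ b P p₃
  with _ , refl , l≤ ← ⊆-^ a Q p₄
  = subframe i≤ p₂ j≤ l≤

length-shape : ∀ i y j l → length (b ^ i ++ y ++ b ^ j ++ a ^ l) ≡ i + (length y + (j + l))
length-shape i y j l = begin
  length (b ^ i ++ y ++ b ^ j ++ a ^ l)     ≡⟨ length-^-++ b i _ ⟩
  i + length (y ++ b ^ j ++ a ^ l)          ≡⟨ cong (i +_) (length-++ y) ⟩
  i + (length y + length (b ^ j ++ a ^ l))  ≡⟨ cong (λ k → i + (length y + k)) (length-^-++ b j _) ⟩
  i + (length y + (j + length (a ^ l)))     ≡⟨ cong (λ k → i + (length y + (j + k))) (length-replicate l) ⟩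
  i + (length y + (j + l))                  ∎
  where open ≡-Reasoning

reverse-shape : ∀ i y j l → reverse (b ^ i ++ y ++ b ^ j ++ a ^ l) ≡ a ^ l ++ b ^ j ++ reverse (b ^ i ++ y)
reverse-shape i y j l = begin
  reverse (b ^ i ++ y ++ b ^ j ++ a ^ l)                   ≡⟨ cong reverse (++-assoc (b ^ i) y _) ⟨
  reverse ((b ^ i ++ y) ++ b ^ j ++ a ^ l)                 ≡⟨ reverse-++ (b ^ i ++ y) _ ⟩
  reverse (b ^ j ++ a ^ l) ++ reverse (b ^ i ++ y)         ≡⟨ cong (_++ reverse (b ^ i ++ y)) (reverse-++ (b ^ j) (a ^ l)) ⟩
  (reverse (a ^ l) ++ reverse (b ^ j)) ++ reverse (b ^ i ++ y) ≡⟨ ++-assoc (reverse (a ^ l)) _ _ ⟩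
  reverse (a ^ l) ++ reverse (b ^ j) ++ reverse (b ^ i ++ y)
    ≡⟨ cong₂ (λ x z → x ++ z ++ reverse (b ^ i ++ y)) (reverse-^ a l) (reverse-^ b j) ⟩
  a ^ l ++ b ^ j ++ reverse (b ^ i ++ y)                   ∎
  where open ≡-Reasoning

count-shape : ∀ c i y j l →
  count c (b ^ i ++ y ++ b ^ j ++ a ^ l) ≡ count c (b ^ i) + (count c y + (count c (b ^ j) + count c (a ^ l)))
count-shape c i y j l = begin
  count c (b ^ i ++ y ++ b ^ j ++ a ^ l)                    ≡⟨ count-++ c (b ^ i) _ ⟩
  count c (b ^ i) + count c (y ++ b ^ j ++ a ^ l)           ≡⟨ cong (count c (b ^ i) +_) (count-++ c y _) ⟩
  count c (b ^ i) + (count c y + count c (b ^ j ++ a ^ l))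
    ≡⟨ cong (λ k → count c (b ^ i) + (count c y + k)) (count-++ c (b ^ j) _) ⟩
  count c (b ^ i) + (count c y + (count c (b ^ j) + count c (a ^ l))) ∎
  where open ≡-Reasoning

count-a-shape : ∀ i y j l → count a (b ^ i ++ y ++ b ^ j ++ a ^ l) ≡ count a y + l
count-a-shape i y j l = trans (count-shape a i y j l)
  (cong₂ (λ x z → x + (count a y + z)) (count-complement-^ a i)
    (cong₂ _+_ (count-complement-^ a j) (count-^ a l)))

count-b-shape : ∀ i y j l → count b (b ^ i ++ y ++ b ^ j ++ a ^ l) ≡ i + (count b y + j)
count-b-shape i y j l = trans (count-shape b i y j l)
  (cong₂ (λ x z → x + (count b y + z)) (count-^ b i)
    (trans (cong₂ _+_ (count-^ b j) (count-complement-^ b l)) (+-identityʳ j)))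

length-shape-≤ : ∀ y {e j l N P} → l ≤ e → e + length y ≤ N → j ≤ P →
  length (y ++ b ^ j ++ a ^ l) ≤ N + P
length-shape-≤ y {e} {j} {l} {N} {P} l≤e e+y≤N j≤P = begin
  length (y ++ b ^ j ++ a ^ l) ≡⟨ length-shape 0 y j l ⟩
  length y + (j + l)           ≤⟨ +-monoʳ-≤ (length y) (+-monoʳ-≤ j l≤e) ⟩
  length y + (j + e)           ≡⟨ regroup (length y) j e ⟩
  (e + length y) + j           ≤⟨ +-mono-≤ e+y≤N j≤P ⟩
  N + P                        ∎
  where
  open ≤-Reasoning
  regroup : ∀ y j e → y + (j + e) ≡ (e + y) + j
  regroup = solve-∀

palindrome-bound-no-a-tail : ∀ {n P i y j} → suc (n + n) ≤ P → i ≤ suc n → y ⊆ ab^ n → j ≤ P →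
  IsPalindrome (b ^ i ++ y ++ b ^ j ++ []) → length (b ^ i ++ y ++ b ^ j ++ []) ≤ suc (n + n) + P
palindrome-bound-no-a-tail {n} {P} {i} {y} {j} _ i≤ y⊆ j≤ pal with run b y
... | only t = begin
  length (b ^ i ++ b ^ t ++ b ^ j ++ []) ≡⟨ length-shape i (b ^ t) j 0 ⟩
  i + (length (b ^ t) + (j + 0))         ≡⟨ cong (λ k → i + (k + (j + 0))) (length-replicate t) ⟩
  i + (t + (j + 0))                      ≤⟨ +-mono-≤ i≤ (+-mono-≤ (^-⊆-ab^ b t n y⊆) (+-monoˡ-≤ 0 j≤)) ⟩
  suc n + (n + (P + 0))                  ≡⟨ regroup n P ⟩
  suc (n + n) + P                        ∎
  where
  open ≤-Reasoning
  regroup : ∀ n P → suc n + (n + (P + 0)) ≡ suc (n + n) + P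
  regroup = solve-∀
palindrome-bound-no-a-tail {n} {P} {i} {y} {j} 2n+1≤P i≤ y⊆ j≤ pal | switch t s = begin
  length (b ^ i ++ y ++ b ^ j ++ [])  ≡⟨ length-shape i y j 0 ⟩
  i + (length y + (j + 0))            ≤⟨ +-monoʳ-≤ i (+-monoʳ-≤ (length y) (+-monoˡ-≤ 0 j≤i+t)) ⟩
  i + (length y + ((i + t) + 0))      ≡⟨ regroup i t (length y) ⟩
  (i + i) + (t + length y)            ≤⟨ +-mono-≤ (+-mono-≤ i≤ i≤) (b^-++-⊆-ab^-length t n y⊆) ⟩
  (suc n + suc n) + (n + n)           ≡⟨ regroup′ n ⟩
  suc (n + n) + suc (n + n)           ≤⟨ +-monoʳ-≤ (suc (n + n)) 2n+1≤P ⟩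
  suc (n + n) + P                     ∎
  where
  open ≤-Reasoning
  j≤i+t : j ≤ i + t
  j≤i+t = palindrome-run-≤ j (i + t) pal (reverse-shape i y j 0) (^-++-^-++ b i t (a ∷ s) _)
  regroup : ∀ i t y → i + (y + ((i + t) + 0)) ≡ (i + i) + (t + y)
  regroup = solve-∀
  regroup′ : ∀ n → (suc n + suc n) + (n + n) ≡ suc (n + n) + suc (n + n)
  regroup′ = solve-∀

palindrome-bound-a-tail : ∀ {n P Q y j l} → n + Q ≤ suc (n + n) + P → y ⊆ ab^ n → j ≤ P → suc l ≤ Q →
  IsPalindrome (y ++ b ^ j ++ a ^ suc l) → length (y ++ b ^ j ++ a ^ suc l) ≤ suc (n + n) + P
palindrome-bound-a-tail {n} {y = y} {j} {l} _ y⊆ j≤ _ pal with run a y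
... | switch e s = length-shape-≤ y
        (palindrome-run-≤ (suc l) e pal (reverse-shape 0 y j (suc l)) (++-assoc (a ^ e) (b ∷ s) _))
        (a^-++-⊆-ab^-length e n y⊆) j≤
palindrome-bound-a-tail {n} {y = y} {suc j} {l} _ y⊆ j≤ _ pal | only e =
  length-shape-≤ y (palindrome-run-≤ (suc l) e pal (reverse-shape 0 y (suc j) (suc l)) refl)
    e+e≤2n+1 j≤
  where
  e+e≤2n+1 : e + length (a ^ e) ≤ suc (n + n)
  e+e≤2n+1 = subst (λ k → e + k ≤ suc (n + n)) (sym (length-replicate e))
    (m≤n⇒m≤1+n (+-mono-≤ (^-⊆-ab^ a e n y⊆) (^-⊆-ab^ a e n y⊆)))
palindrome-bound-a-tail {n} {P} {Q} {y} {zero} {l} n+Q≤ y⊆ _ l≤ pal | only e = begin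
  length (a ^ e ++ a ^ suc l) ≡⟨ length-^-++ a e (a ^ suc l) ⟩
  e + length (a ^ suc l)      ≡⟨ cong (e +_) (length-replicate (suc l)) ⟩
  e + suc l                   ≤⟨ +-mono-≤ (^-⊆-ab^ a e n y⊆) l≤ ⟩
  n + Q                       ≤⟨ n+Q≤ ⟩
  suc (n + n) + P             ∎
  where open ≤-Reasoning

palindrome-bound : ∀ {n P Q u} → suc (n + n) ≤ P → n + Q ≤ suc (n + n) + P →
  Subframe n P Q u → IsPalindrome u → length u ≤ suc (n + n) + P
palindrome-bound 2n+1≤P _ (subframe {l = zero} i≤ y⊆ j≤ _) pal =
  palindrome-bound-no-a-tail 2n+1≤P i≤ y⊆ j≤ pal
palindrome-bound _ n+Q≤ (subframe {zero} {l = suc l} _ y⊆ j≤ l≤) pal =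
  palindrome-bound-a-tail n+Q≤ y⊆ j≤ l≤ pal
palindrome-bound _ _ (subframe {suc i} {y} {j} {suc l} _ _ _ _) pal -- starts with b, ends with a
  with () ← palindrome-run-≤ (suc l) 0 pal (reverse-shape (suc i) y j (suc l)) refl

antipalindrome-bound : ∀ {n P Q u} → suc (n + n) ≤ Q →
  Subframe n P Q u → IsAntipalindrome u → length u ≤ Q + Q
antipalindrome-bound {n} {P} {Q} 2n+1≤Q (subframe {i} {y} {zero} {l} i≤ y⊆ _ _) anti =
  antipalindrome-length b anti (begin
    count b (b ^ i ++ y ++ a ^ l) ≡⟨ count-b-shape i y 0 l ⟩
    i + (count b y + 0)           ≡⟨ cong (i +_) (+-identityʳ (count b y)) ⟩
    i + count b y                 ≤⟨ +-mono-≤ i≤ (subst (count b y ≤_) (count-ab^ b n) (count-mono b y⊆)) ⟩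
    suc n + n                     ≤⟨ 2n+1≤Q ⟩
    Q                             ∎)
  where open ≤-Reasoning
antipalindrome-bound {n} {P} {Q} 2n+1≤Q (subframe {i} {y} {suc j} {l} i≤ y⊆ _ l≤) anti with run b y
... | only t = antipalindrome-length a anti (begin
    count a (b ^ i ++ b ^ t ++ b ^ suc j ++ a ^ l) ≡⟨ count-a-shape i (b ^ t) (suc j) l ⟩
    count a (b ^ t) + l                            ≡⟨ cong (_+ l) (count-complement-^ a t) ⟩
    l                                              ≤⟨ l≤ ⟩
    Q                                              ∎)
  where open ≤-Reasoning
... | switch t s = antipalindrome-length a anti (begin
    count a (b ^ i ++ y ++ b ^ suc j ++ a ^ l) ≡⟨ count-a-shape i y (suc j) l ⟩
    count a y + l                              ≤⟨ +-monoʳ-≤ (count a y) l≤i+t ⟩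
    count a y + (i + t)                        ≡⟨ regroup (count a y) i t ⟩
    i + (t + count a y)                        ≤⟨ +-mono-≤ i≤ (b^-++-⊆-ab^-count t n y⊆) ⟩
    suc n + n                                  ≤⟨ 2n+1≤Q ⟩
    Q                                          ∎)
  where
  open ≤-Reasoning
  l≤i+t : l ≤ i + t
  l≤i+t = antipalindrome-run-≤ l (i + t) anti (reverse-shape i y (suc j) l) (^-++-^-++ b i t (a ∷ s) _)
  regroup : ∀ c i t → c + (i + t) ≡ i + (t + c)
  regroup = solve-∀

Sd≥-frame : ∀ n P Q k → suc (n + n) ≤ P → suc (n + n) ≤ Q → n + Q ≤ suc (n + n) + P →
  k + (suc (n + n) + P) ≤ length (frame n P Q) → k + (Q + Q) ≤ length (frame n P Q) →
  Sd≥ (frame n P Q) k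
Sd≥-frame n P Q k 2n+1≤P 2n+1≤Q n+Q≤ pal-fits anti-fits u u⊆ pal-or-anti =
  m+n≤o⇒m≤o∸n k (bound pal-or-anti)
  where
  subframe-u : Subframe n P Q u
  subframe-u = ⊆-frame⇒Subframe n P Q u⊆
  bound : PalOrAnti u → k + length u ≤ length (frame n P Q)
  bound (inj₁ pal)  = ≤-trans (+-monoʳ-≤ k (palindrome-bound 2n+1≤P n+Q≤ subframe-u pal)) pal-fits
  bound (inj₂ anti) = ≤-trans (+-monoʳ-≤ k (antipalindrome-bound 2n+1≤Q subframe-u anti)) anti-fits

Sd≥-wNAB : ∀ n α β q → q ≤ β → q + β ≤ α → Sd≥ (wNAB n α β) (3 * n + 1 + q)
Sd≥-wNAB n α β q q≤β q+β≤α = Sd≥-frame n P Q (3 * n + 1 + q)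
  (≤-trans (m≤m+n _ α) (≤-reflexive (sym (P≡ n α))))
  (≤-trans (m≤m+n _ β) (≤-reflexive (sym (P≡ n β))))
  (+-mono-≤ (m≤n⇒m≤1+n (m≤m+n n n)) (+-monoʳ-≤ (2 * n + 1) β≤α))
  (begin
    3 * n + 1 + q + (suc (n + n) + P)       ≤⟨ +-monoˡ-≤ _ (+-monoʳ-≤ (3 * n + 1) q≤β) ⟩
    3 * n + 1 + β + (suc (n + n) + P)       ≡⟨ pal-eq n α β ⟩
    suc n + ((n + n) + (P + Q))             ≡⟨ length-frame n P Q ⟨
    length (frame n P Q)                    ∎)
  (begin
    3 * n + 1 + q + (Q + Q)                 ≡⟨ anti-eq n β q ⟩
    (7 * n + 3 + β) + (q + β)               ≤⟨ +-monoʳ-≤ (7 * n + 3 + β) q+β≤α ⟩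
    (7 * n + 3 + β) + α                     ≡⟨ total n α β ⟩
    suc n + ((n + n) + (P + Q))             ≡⟨ length-frame n P Q ⟨
    length (frame n P Q)                    ∎)
  where
  open ≤-Reasoning
  P = 2 * n + 1 + α
  Q = 2 * n + 1 + β
  β≤α : β ≤ α
  β≤α = ≤-trans (m≤n+m β q) q+β≤α
  P≡ : ∀ n α → 2 * n + 1 + α ≡ suc (n + n) + α
  P≡ = solve-∀
  pal-eq : ∀ n α β → 3 * n + 1 + β + (suc (n + n) + (2 * n + 1 + α))
                   ≡ suc n + ((n + n) + ((2 * n + 1 + α) + (2 * n + 1 + β)))
  pal-eq = solve-∀
  anti-eq : ∀ n β q → 3 * n + 1 + q + ((2 * n + 1 + β) + (2 * n + 1 + β))
                    ≡ (7 * n + 3 + β) + (q + β)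
  anti-eq = solve-∀
  total : ∀ n α β → (7 * n + 3 + β) + α
                  ≡ suc n + ((n + n) + ((2 * n + 1 + α) + (2 * n + 1 + β)))
  total = solve-∀

admissible-bounds : ∀ {α β} → Admissible α β → (α + β) / 3 ≤ β × (α + β) / 3 + β ≤ α
admissible-bounds p00 = ≤ᵇ⇒≤ _ _ _ , ≤ᵇ⇒≤ _ _ _
admissible-bounds p10 = ≤ᵇ⇒≤ _ _ _ , ≤ᵇ⇒≤ _ _ _
admissible-bounds p11 = ≤ᵇ⇒≤ _ _ _ , ≤ᵇ⇒≤ _ _ _
admissible-bounds p21 = ≤ᵇ⇒≤ _ _ _ , ≤ᵇ⇒≤ _ _ _
admissible-bounds p31 = ≤ᵇ⇒≤ _ _ _ , ≤ᵇ⇒≤ _ _ _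
admissible-bounds p32 = ≤ᵇ⇒≤ _ _ _ , ≤ᵇ⇒≤ _ _ _
admissible-bounds p42 = ≤ᵇ⇒≤ _ _ _ , ≤ᵇ⇒≤ _ _ _

lemma4 : (n α β : ℕ) → 1 ≤ n → Admissible α β →
    Sd≥ (wNAB n α β) (3 * n + 1 + (α + β) / 3)
-- The bound holds for n = 0 as well.
lemma4 n α β _ adm with q≤β , q+β≤α ← admissible-bounds adm = Sd≥-wNAB n α β _ q≤β q+β≤α
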